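{- Let $H$ be a finite $k$-uniform hypergraph and let $f$ be a perfect coloring of $H$. Define the coloring $f'$ of the line graph $\mathcal{E}(H)$ by letting $f'(e)$ be the multiset $\{f(v_1),\dots,f(v_k)\}$ for each hyperedge $e=\{v_1,\dots,v_k\}$. Then $f'$ is a perfect coloring of $\mathcal{E}(H)$.
   Context: The line graph $\mathcal{E}(H)$ of a $k$-uniform hypergraph $H$ is the multigraph whose vertices are the hyperedges of $H$, two distinct hyperedges $e,e'$ being joined by $|e\cap e'|$ edges (no loops); its adjacency matrix is $Y^{*}Y-kI$ where $Y$ is the vertex–hyperedge incidence matrix. A coloring $f$ of the vertices of $H$ is perfect if for any two vertices $x,y$ with $f(x)=f(y)$ and any multiset $\mu$ of colors, the number of hyperedges containing $x$ whose multiset of vertex colors is $\mu$ equals that for $y$. For a multigraph with adjacency matrix $M$, a coloring $g$ is perfect if there is $S=(s_{ij})$ with $\sum_{z:\,g(z)=j}M_{xz}=s_{ij}$ for all colors $i,j$ and every vertex $x$ of color $i$. -}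

module Defs where

open import Data.Nat using (ℕ; zero; suc; _+_; _*_)
import Data.Nat as ℕ
open import Data.Vec.Properties using (≡-dec)
open import Data.Bool using (Bool; true; false)
open import Data.Fin using (Fin; zero; suc) renaming (_≟_ to _≟F_)
open import Data.Fin.Subset using (Subset; _∈_; _∩_; ∣_∣)
open import Data.Fin.Subset.Properties using (_∈?_)
open import Data.Vec using (Vec; tabulate)
open import Data.Product using (∃)
open import Relation.Nullary using (Dec; yes; no; ¬_; _×-dec_)
open import Relation.Binary.Definitions using (DecidableEquality)
open import Relation.Binary.PropositionalEquality using (_≡_)
open import Function.Definitions using (Injective)

Σ[<] : (m : ℕ) → (Fin m → ℕ) → ℕ
Σ[<] zero    f = 0
Σ[<] (suc m) f = f zero + Σ[<] m (λ i → f (suc i))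

[_] : ∀ {p} {P : Set p} → Dec P → ℕ
[ yes _ ] = 1
[ no  _ ] = 0

count : ∀ {p} (m : ℕ) {P : Fin m → Set p} → ((i : Fin m) → Dec (P i)) → ℕ
count m d = Σ[<] m (λ i → [ d i ])

-- A finite k-uniform hypergraph on vertex set Fin n with hyperedges indexed
-- by Fin m; each hyperedge is a k-element subset of the vertices, and
-- distinct indices give distinct hyperedges (the hyperedges form a set).
record UniformHypergraph (n m k : ℕ) : Set where
  field
    edge     : Fin m → Subset n
    uniform  : ∀ e → ∣ edge e ∣ ≡ k
    distinct : Injective _≡_ _≡_ edge
open UniformHypergraph public

-- Multisets of colors from Fin c, represented by their multiplicity vectors.
Multiset : ℕ → Set
Multiset c = Vec ℕ c

edgeColors : ∀ {n m k c} → UniformHypergraph n m k → (Fin n → Fin c) →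
             Fin m → Multiset c
edgeColors {n} H f e =
  tabulate (λ j → count n (λ v → (v ∈? edge H e) ×-dec (f v ≟F j)))

IsPerfectHypergraphColoring : ∀ {n m k c} → UniformHypergraph n m k →
                              (Fin n → Fin c) → Set
IsPerfectHypergraphColoring {n} {m} {k} {c} H f =
  ∀ (x y : Fin n) → f x ≡ f y → (μ : Multiset c) →
    count m (λ e → (x ∈? edge H e) ×-dec (edgeColors H f e ≟μ μ))
    ≡ count m (λ e → (y ∈? edge H e) ×-dec (edgeColors H f e ≟μ μ))
  where
  _≟μ_ = ≡-dec ℕ._≟_

lineGraph : ∀ {n m k} → UniformHypergraph n m k → Fin m → Fin m → ℕ
lineGraph H e e' with e ≟F e'
... | yes _ = 0
... | no  _ = ∣ edge H e ∩ edge H e' ∣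

IsPerfectMultigraphColoring : ∀ {N} {C : Set} → DecidableEquality C →
                              (Fin N → Fin N → ℕ) → (Fin N → C) → Set
IsPerfectMultigraphColoring {N} {C} _≟C_ M g =
  ∃ λ (S : C → C → ℕ) → ∀ (i j : C) (x : Fin N) → g x ≡ i →
    Σ[<] N (λ z → M x z * [ g z ≟C j ]) ≡ S i j

-- Fix a hyperedge e with colour multiset μ and a colour multiset ν, and count the pairs (v, z)
-- with v ∈ e ∩ z and z of colour multiset ν in two ways. Summing |e ∩ z| over z gives the
-- number of line-graph edges from e to colour class ν, plus k for z = e itself when μ = ν.
-- Summing over v ∈ e gives the sum of d_ν(v), the number of hyperedges through v of colour
-- multiset ν; by perfectness d_ν(v) depends only on f(v), so this is Σ_j μ_j d_ν(j). Hence
-- the line-graph count is Σ_j μ_j d_ν(j) − k [μ = ν], which depends on μ and ν only.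
module Submission where

open import Defs
import Data.Nat as ℕ
open import Data.Nat using (ℕ; zero; suc; _+_; _*_; _∸_)
open import Data.Nat.Properties
  using (+-*-semiring; +-identityʳ; *-identityˡ; *-identityʳ; *-zeroʳ; *-assoc; *-distribʳ-+; m+n∸n≡m)
open import Algebra.Properties.Semiring.Sum +-*-semiring
  using (sum; sum-syntax; sum-cong-≗; sum-remove; sum-replicate-zero; ∑-distrib-+; ∑-comm;
         *-distribˡ-sum; *-distribʳ-sum)
open import Data.Fin using (Fin; zero; suc; punchIn) renaming (_≟_ to _≟F_)
open import Data.Fin.Properties using (any?; punchInᵢ≢i)
open import Data.Fin.Subset using (Subset; _∩_; ∣_∣; inside; outside)
open import Data.Fin.Subset.Properties using (_∈?_; ∩-idem; x∈p∩q⁺; x∈p∩q⁻; drop-there)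
open import Data.Vec using ([]; _∷_; there; lookup)
open import Data.Vec.Properties using (≡-dec; lookup∘tabulate)
open import Data.Product using (∃; _,_; proj₁; proj₂)
open import Data.Empty using (⊥-elim)
open import Function using (_∘_)
open import Relation.Nullary using (Dec; yes; no; ¬_; _×-dec_)
open import Relation.Binary.Definitions using (DecidableEquality)
open import Relation.Binary.PropositionalEquality
  using (_≡_; refl; sym; trans; cong; cong₂; module ≡-Reasoning)
open ≡-Reasoning

indicator-yes : ∀ {p} {P : Set p} (d : Dec P) → P → [ d ] ≡ 1
indicator-yes (yes _) _ = refl
indicator-yes (no ¬p) p = ⊥-elim (¬p p)

indicator-no : ∀ {p} {P : Set p} (d : Dec P) → ¬ P → [ d ] ≡ 0
indicator-no (yes p) ¬p = ⊥-elim (¬p p)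
indicator-no (no _)  _  = refl

indicator-cong : ∀ {p q} {P : Set p} {Q : Set q} → (P → Q) → (Q → P) →
                 (d : Dec P) (d′ : Dec Q) → [ d ] ≡ [ d′ ]
indicator-cong _ _ (yes _) (yes _) = refl
indicator-cong f _ (yes p) (no ¬q) = ⊥-elim (¬q (f p))
indicator-cong _ g (no ¬p) (yes q) = ⊥-elim (¬p (g q))
indicator-cong _ _ (no _)  (no _)  = refl

indicator-×-dec : ∀ {p q} {P : Set p} {Q : Set q} (d : Dec P) (d′ : Dec Q) →
                  [ d ×-dec d′ ] ≡ [ d ] * [ d′ ]
indicator-×-dec (yes _) (yes _) = refl
indicator-×-dec (yes _) (no _)  = refl
indicator-×-dec (no _)  _       = refl

Σ[<]≡sum : ∀ m (f : Fin m → ℕ) → Σ[<] m f ≡ sum f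
Σ[<]≡sum zero    f = refl
Σ[<]≡sum (suc m) f = cong (f zero +_) (Σ[<]≡sum m (f ∘ suc))

count-×-dec : ∀ {p q} m {P : Fin m → Set p} {Q : Fin m → Set q}
              (d : ∀ i → Dec (P i)) (d′ : ∀ i → Dec (Q i)) →
              count m (λ i → d i ×-dec d′ i) ≡ ∑[ i < m ] ([ d i ] * [ d′ i ])
count-×-dec m d d′ = trans (Σ[<]≡sum m _) (sum-cong-≗ (λ i → indicator-×-dec (d i) (d′ i)))

∑-δ : ∀ {n} (i : Fin n) (g : Fin n → ℕ) → ∑[ j < n ] ([ i ≟F j ] * g j) ≡ g i
∑-δ {suc n} i g = begin
  sum δg                        ≡⟨ sum-remove {i = i} δg ⟩
  δg i + sum (δg ∘ punchIn i)   ≡⟨ cong₂ _+_ δg-diagonal (sum-cong-≗ δg-off-diagonal) ⟩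
  g i + ∑[ j < n ] 0            ≡⟨ cong (g i +_) (sum-replicate-zero n) ⟩
  g i + 0                       ≡⟨ +-identityʳ (g i) ⟩
  g i                           ∎
  where
  δg : Fin (suc n) → ℕ
  δg j = [ i ≟F j ] * g j
  δg-diagonal : δg i ≡ g i
  δg-diagonal = trans (cong (_* g i) (indicator-yes (i ≟F i) refl)) (*-identityˡ (g i))
  δg-off-diagonal : ∀ j → δg (punchIn i j) ≡ 0
  δg-off-diagonal j =
    cong (_* g (punchIn i j)) (indicator-no (i ≟F punchIn i j) (punchInᵢ≢i i j ∘ sym))

∑-by-fibres : ∀ {n c} (f : Fin n → Fin c) (w : Fin n → ℕ) →
              sum w ≡ ∑[ j < c ] ∑[ v < n ] ([ f v ≟F j ] * w v)
∑-by-fibres f w = trans (sum-cong-≗ (λ v → sym (∑-δ (f v) (λ _ → w v))))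
                        (∑-comm (λ v j → [ f v ≟F j ] * w v))

∑-suc-∈?-∷ : ∀ {n} x (p : Subset n) → ∑[ v < n ] [ suc v ∈? x ∷ p ] ≡ ∑[ v < n ] [ v ∈? p ]
∑-suc-∈?-∷ x p = sum-cong-≗ (λ v → indicator-cong drop-there there (suc v ∈? x ∷ p) (v ∈? p))

∣p∣≡∑ : ∀ {n} (p : Subset n) → ∣ p ∣ ≡ ∑[ v < n ] [ v ∈? p ]
∣p∣≡∑ []            = refl
∣p∣≡∑ (inside  ∷ p) = cong suc (trans (∣p∣≡∑ p) (sym (∑-suc-∈?-∷ inside p)))
∣p∣≡∑ (outside ∷ p) = trans (∣p∣≡∑ p) (sym (∑-suc-∈?-∷ outside p))

∣p∩q∣≡∑ : ∀ {n} (p q : Subset n) → ∣ p ∩ q ∣ ≡ ∑[ v < n ] ([ v ∈? p ] * [ v ∈? q ])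
∣p∩q∣≡∑ p q = trans (∣p∣≡∑ (p ∩ q)) (sum-cong-≗ λ v →
  trans (indicator-cong (x∈p∩q⁻ p q) x∈p∩q⁺ (v ∈? p ∩ q) ((v ∈? p) ×-dec (v ∈? q)))
        (indicator-×-dec (v ∈? p) (v ∈? q)))

factorise : ∀ {n} {B C : Set} → DecidableEquality C → B → (f : Fin n → C) (g : Fin n → B) →
            (∀ x y → f x ≡ f y → g x ≡ g y) → ∃ λ (h : C → B) → ∀ x → g x ≡ h (f x)
factorise {B = B} {C} _≟_ default f g g-respects-f = h , g≡h∘f
  where
  h : C → B
  h j with any? (λ v → f v ≟ j)
  ... | yes (w , _) = g w
  ... | no _        = default
  g≡h∘f : ∀ x → g x ≡ h (f x)
  g≡h∘f x with any? (λ v → f v ≟ f x)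
  ... | yes (w , fw≡fx) = g-respects-f x w (sym fw≡fx)
  ... | no ∄w           = ⊥-elim (∄w (x , refl))

_≟μ_ : ∀ {c} → DecidableEquality (Multiset c)
_≟μ_ = ≡-dec ℕ._≟_

module _ {n m k c : ℕ} (H : UniformHypergraph n m k) (f : Fin n → Fin c) where

  colours : Fin m → Multiset c
  colours = edgeColors H f

  incidence : Fin n → Fin m → ℕ
  incidence v e = [ v ∈? edge H e ]

  lineGraphDegree : Fin m → Multiset c → ℕ
  lineGraphDegree e ν = Σ[<] m (λ z → lineGraph H e z * [ colours z ≟μ ν ])

  degree : Fin n → Multiset c → ℕ
  degree v ν = count m (λ e → (v ∈? edge H e) ×-dec (colours e ≟μ ν))

  lineGraph+diagonal : ∀ e z → lineGraph H e z + [ e ≟F z ] * k ≡ ∣ edge H e ∩ edge H z ∣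
  lineGraph+diagonal e z with e ≟F z
  ... | yes refl = trans (+-identityʳ k) (sym (trans (cong ∣_∣ (∩-idem (edge H e))) (uniform H e)))
  ... | no _     = +-identityʳ _

  double-counting : ∀ e ν → ∑[ z < m ] (∣ edge H e ∩ edge H z ∣ * [ colours z ≟μ ν ])
                          ≡ ∑[ v < n ] (incidence v e * degree v ν)
  double-counting e ν = begin
    ∑[ z < m ] (∣ edge H e ∩ edge H z ∣ * χ z)
      ≡⟨ sum-cong-≗ (λ z → cong (_* χ z) (∣p∩q∣≡∑ (edge H e) (edge H z))) ⟩
    ∑[ z < m ] (∑[ v < n ] (incidence v e * incidence v z) * χ z)
      ≡⟨ sum-cong-≗ (λ z → trans (*-distribʳ-sum (χ z) (λ v → incidence v e * incidence v z))
                                 (sum-cong-≗ (λ v → *-assoc (incidence v e) (incidence v z) (χ z)))) ⟩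
    ∑[ z < m ] ∑[ v < n ] (incidence v e * (incidence v z * χ z))
      ≡⟨ ∑-comm (λ z v → incidence v e * (incidence v z * χ z)) ⟩
    ∑[ v < n ] ∑[ z < m ] (incidence v e * (incidence v z * χ z))
      ≡⟨ sum-cong-≗ (λ v → sym (*-distribˡ-sum (incidence v e) (λ z → incidence v z * χ z))) ⟩
    ∑[ v < n ] (incidence v e * ∑[ z < m ] (incidence v z * χ z))
      ≡⟨ sum-cong-≗ (λ v → cong (incidence v e *_) (sym (degree≡∑ v))) ⟩
    ∑[ v < n ] (incidence v e * degree v ν) ∎
    where
    χ : Fin m → ℕ
    χ z = [ colours z ≟μ ν ]
    degree≡∑ : ∀ v → degree v ν ≡ ∑[ z < m ] (incidence v z * χ z)
    degree≡∑ v = count-×-dec m (λ z → v ∈? edge H z) (λ z → colours z ≟μ ν)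

  lineGraph-degree : ∀ e ν → lineGraphDegree e ν + k * [ colours e ≟μ ν ]
                           ≡ ∑[ v < n ] (incidence v e * degree v ν)
  lineGraph-degree e ν = begin
    lineGraphDegree e ν + k * χ e
      ≡⟨ cong₂ _+_ (Σ[<]≡sum m _) (sym (∑-δ e (λ z → k * χ z))) ⟩
    ∑[ z < m ] (lineGraph H e z * χ z) + ∑[ z < m ] ([ e ≟F z ] * (k * χ z))
      ≡⟨ sym (∑-distrib-+ (λ z → lineGraph H e z * χ z) (λ z → [ e ≟F z ] * (k * χ z))) ⟩
    ∑[ z < m ] (lineGraph H e z * χ z + [ e ≟F z ] * (k * χ z))
      ≡⟨ sum-cong-≗ (λ z → sym (split-diagonal z)) ⟩
    ∑[ z < m ] (∣ edge H e ∩ edge H z ∣ * χ z)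
      ≡⟨ double-counting e ν ⟩
    ∑[ v < n ] (incidence v e * degree v ν) ∎
    where
    χ : Fin m → ℕ
    χ z = [ colours z ≟μ ν ]
    split-diagonal : ∀ z → ∣ edge H e ∩ edge H z ∣ * χ z
                         ≡ lineGraph H e z * χ z + [ e ≟F z ] * (k * χ z)
    split-diagonal z = begin
      ∣ edge H e ∩ edge H z ∣ * χ z
        ≡⟨ cong (_* χ z) (lineGraph+diagonal e z) ⟨
      (lineGraph H e z + [ e ≟F z ] * k) * χ z
        ≡⟨ *-distribʳ-+ (χ z) (lineGraph H e z) ([ e ≟F z ] * k) ⟩
      lineGraph H e z * χ z + [ e ≟F z ] * k * χ z
        ≡⟨ cong (lineGraph H e z * χ z +_) (*-assoc [ e ≟F z ] k (χ z)) ⟩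
      lineGraph H e z * χ z + [ e ≟F z ] * (k * χ z) ∎

  ∑-over-edge : ∀ e (w : Fin c → ℕ) → ∑[ v < n ] (incidence v e * w (f v))
                                     ≡ ∑[ j < c ] (lookup (colours e) j * w j)
  ∑-over-edge e w = begin
    ∑[ v < n ] (incidence v e * w (f v))
      ≡⟨ ∑-by-fibres f (λ v → incidence v e * w (f v)) ⟩
    ∑[ j < c ] ∑[ v < n ] ([ f v ≟F j ] * (incidence v e * w (f v)))
      ≡⟨ sum-cong-≗ (λ j → sum-cong-≗ (λ v → on-fibre v j)) ⟩
    ∑[ j < c ] ∑[ v < n ] (incidence v e * [ f v ≟F j ] * w j)
      ≡⟨ sum-cong-≗ (λ j → sym (*-distribʳ-sum (w j) (λ v → incidence v e * [ f v ≟F j ]))) ⟩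
    ∑[ j < c ] (∑[ v < n ] (incidence v e * [ f v ≟F j ]) * w j)
      ≡⟨ sum-cong-≗ (λ j → cong (_* w j) (sym (multiplicity j))) ⟩
    ∑[ j < c ] (lookup (colours e) j * w j) ∎
    where
    on-fibre : ∀ v j → [ f v ≟F j ] * (incidence v e * w (f v)) ≡ incidence v e * [ f v ≟F j ] * w j
    on-fibre v j with f v ≟F j
    ... | yes refl = trans (+-identityʳ _) (cong (_* w (f v)) (sym (*-identityʳ (incidence v e))))
    ... | no _     = cong (_* w j) (sym (*-zeroʳ (incidence v e)))
    multiplicity : ∀ j → lookup (colours e) j ≡ ∑[ v < n ] (incidence v e * [ f v ≟F j ])
    multiplicity j = trans (lookup∘tabulate _ j) (count-×-dec n (_∈? edge H e) (λ v → f v ≟F j))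

  module _ (perfect : IsPerfectHypergraphColoring H f) where

    degree-factorises : ∀ ν → ∃ λ (h : Fin c → ℕ) → ∀ v → degree v ν ≡ h (f v)
    degree-factorises ν = factorise _≟F_ 0 f (λ v → degree v ν) (λ x y fx≡fy → perfect x y fx≡fy ν)

    -- colours outside the image of f get the junk value 0
    colourDegree : Multiset c → Fin c → ℕ
    colourDegree ν = proj₁ (degree-factorises ν)

    degree≡colourDegree : ∀ v ν → degree v ν ≡ colourDegree ν (f v)
    degree≡colourDegree v ν = proj₂ (degree-factorises ν) v

    lineGraph-colourDegree : ∀ e ν → lineGraphDegree e ν + k * [ colours e ≟μ ν ]
                                   ≡ ∑[ j < c ] (lookup (colours e) j * colourDegree ν j)
    lineGraph-colourDegree e ν = begin
      lineGraphDegree e ν + k * [ colours e ≟μ ν ]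
        ≡⟨ lineGraph-degree e ν ⟩
      ∑[ v < n ] (incidence v e * degree v ν)
        ≡⟨ sum-cong-≗ (λ v → cong (incidence v e *_) (degree≡colourDegree v ν)) ⟩
      ∑[ v < n ] (incidence v e * colourDegree ν (f v))
        ≡⟨ ∑-over-edge e (colourDegree ν) ⟩
      ∑[ j < c ] (lookup (colours e) j * colourDegree ν j) ∎

    lineGraphParameters : Multiset c → Multiset c → ℕ
    lineGraphParameters μ ν = ∑[ j < c ] (lookup μ j * colourDegree ν j) ∸ k * [ μ ≟μ ν ]

    lineGraphDegree≡parameters : ∀ μ ν e → colours e ≡ μ →
                                 lineGraphDegree e ν ≡ lineGraphParameters μ ν
    lineGraphDegree≡parameters _ ν e refl = begin
      lineGraphDegree e ν                         ≡⟨ m+n∸n≡m (lineGraphDegree e ν) diagonal ⟨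
      lineGraphDegree e ν + diagonal ∸ diagonal   ≡⟨ cong (_∸ diagonal) (lineGraph-colourDegree e ν) ⟩
      lineGraphParameters (colours e) ν           ∎
      where
      diagonal : ℕ
      diagonal = k * [ colours e ≟μ ν ]

proposition4 : ∀ {n m k c : ℕ} (H : UniformHypergraph n m k) (f : Fin n → Fin c) →
    IsPerfectHypergraphColoring H f →
    IsPerfectMultigraphColoring (≡-dec ℕ._≟_) (lineGraph H) (edgeColors H f)
proposition4 H f perfect = lineGraphParameters H f perfect , lineGraphDegree≡parameters H f perfect
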